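{- Let $X=[0,1)\cap\mathbb{Q}$ with its usual order $\prec$, let $\mathbf{B}$ be the Boolean algebra of good subsets of $X$ (defined below), and let $e\colon X\cup\{1\}\to\omega$ be a finite-to-one function. Let $\mathbf{C}$ be a countable atomless Boolean subalgebra of $\mathbf{B}$. Then for every non-empty $a\in\mathbf{C}$ and every $n\in\omega$ there exists $b\in\mathbf{C}$ such that $b\subseteq a$ and $\min(\mathrm{int}(b))>n$.
   Context: Each integer $n\ge 0$ is identified with the set $\{0,\dots,n-1\}$, and $\omega$ denotes the set of non-negative integers. A set $a\subseteq X$ is called good if there exist $n<\omega$ and a strictly increasing function $\mathrm{seq}_a\colon 2n\to X\cup\{1\}$ such that for every $x\in X$: $x\in a$ if and only if there is $i<n$ with $\mathrm{seq}_a(2i)\preceq x\prec \mathrm{seq}_a(2i+1)$ (this $\mathrm{seq}_a$ is uniquely determined by $a$). The set $\mathbf{B}$ of all good subsets of $X$ is a Boolean subalgebra of the power set of $X$. For $a\in\mathbf{B}$, put $\mathrm{int}(a)=\{e(u): u\in\mathrm{Im}(\mathrm{seq}_a)\}$. -}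

module Defs where

open import Data.Nat using (ℕ; _<_; _*_; _+_)
open import Data.Rational using (ℚ; 0ℚ; 1ℚ) renaming (_≤_ to _≤ℚ_; _<_ to _<ℚ_)
open import Data.Product using (Σ; ∃; _×_; proj₁; _,_)
open import Data.Sum using (_⊎_)
open import Data.List using (List)
open import Data.List.Membership.Propositional using (_∈_)
open import Relation.Binary.PropositionalEquality using (_≡_)
open import Relation.Nullary using (¬_)

X : Set
X = Σ ℚ (λ q → (0ℚ ≤ℚ q) × (q <ℚ 1ℚ))

-- X ∪ {1} = [0,1] ∩ ℚ
X1 : Set
X1 = Σ ℚ (λ q → (0ℚ ≤ℚ q) × (q ≤ℚ 1ℚ))

Subset : Set₁
Subset = X → Set

_⊆_ : Subset → Subset → Set
a ⊆ b = ∀ x → a x → b x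

Nonempty : Subset → Set
Nonempty a = ∃ λ x → a x

∅ₛ : Subset
∅ₛ _ = ⊥' where open import Data.Empty renaming (⊥ to ⊥')

Xₛ : Subset
Xₛ _ = ⊤' where open import Data.Unit renaming (⊤ to ⊤')

_∪_ : Subset → Subset → Subset
(a ∪ b) x = a x ⊎ b x

_∩_ : Subset → Subset → Subset
(a ∩ b) x = a x × b x

∁ : Subset → Subset
∁ a x = ¬ a x

-- seq : 2n → X ∪ {1}, represented as ℕ → X1 where only the values on
-- indices i < 2n are relevant.  "seq is a witness that a is good, with 2n points":
IsSeq : Subset → ℕ → (ℕ → X1) → Set
IsSeq a n s =
  (∀ i j → i < j → j < 2 * n → proj₁ (s i) <ℚ proj₁ (s j))
  × (∀ (x : X) →
       (a x → ∃ λ i → i < n × (proj₁ (s (2 * i)) ≤ℚ proj₁ x) × (proj₁ x <ℚ proj₁ (s (2 * i + 1))))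
     × ((∃ λ i → i < n × (proj₁ (s (2 * i)) ≤ℚ proj₁ x) × (proj₁ x <ℚ proj₁ (s (2 * i + 1)))) → a x))

Good : Subset → Set
Good a = ∃ λ n → ∃ λ s → IsSeq a n s

FiniteToOne : (X1 → ℕ) → Set
FiniteToOne e = ∀ m → ∃ λ (L : List ℚ) → ∀ (u : X1) → e u ≡ m → proj₁ u ∈ L

record BooleanSubalgebraOfB (C : Subset → Set) : Set₁ where
  field
    good   : ∀ a → C a → Good a
    has-∅  : C ∅ₛ
    has-X  : C Xₛ
    ∪-closed : ∀ a b → C a → C b → C (a ∪ b)
    ∩-closed : ∀ a b → C a → C b → C (a ∩ b)
    ∁-closed : ∀ a → C a → C (∁ a)

_≐_ : Subset → Subset → Set
a ≐ b = (a ⊆ b) × (b ⊆ a)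

Countable : (Subset → Set) → Set₁
Countable C = ∃ λ (f : ℕ → Subset) → (∀ k → C (f k)) × (∀ a → C a → ∃ λ k → f k ≐ a)

Atomless : (Subset → Set) → Set₁
Atomless C = ∀ a → C a → Nonempty a →
  ∃ λ b → C b × (b ⊆ a) × Nonempty b × ¬ (a ⊆ b)

-- min(int(b)) > n, where int(b) = { e(u) : u ∈ Im(seq_b) } (b non-empty so int(b) ≠ ∅)
MinIntAbove : (X1 → ℕ) → Subset → ℕ → Set
MinIntAbove e b n = ∃ λ k → ∃ λ s → IsSeq b k s × (∀ i → i < 2 * k → n < e (s i))

-- A good set is a finite union of half-open intervals [l, r), so near any rational q it
-- either misses a whole neighbourhood of q, or contains an interval [l, r) with l < q ≤ r,
-- or one with l ≤ q < r.  Among three pairwise disjoint good sets at most one contains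
-- intervals of the second kind and at most one of the third, so one of them misses a
-- neighbourhood of q.  Atomlessness cuts any non-empty a ∈ C into three disjoint non-empty
-- pieces in C, so a can be shrunk to a non-empty b ∈ C missing neighbourhoods of each of the
-- finitely many points u with e(u) ≤ n.  Every endpoint of seq_b is approached by points of b,
-- hence is none of these points, i.e. e > n on Im(seq_b).
module Submission where

open import Defs
open import Data.Nat using (ℕ)
open import Data.Product using (∃; _×_)

open import Data.Nat using (zero; suc; _+_; _*_; z≤n; s≤s) renaming (_≤_ to _≤ℕ_; _<_ to _<ℕ_)
import Data.Nat.Properties as ℕ
open import Data.Product using (∃₂; proj₁; proj₂; _,_)
open import Data.Sum using (_⊎_; inj₁; inj₂)
open import Data.Empty using (⊥; ⊥-elim)
open import Data.List using (List; []; _∷_; _++_)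
open import Data.List.Membership.Propositional using (_∈_)
open import Data.List.Membership.Propositional.Properties using (∈-++⁺ˡ; ∈-++⁺ʳ)
open import Data.List.Relation.Unary.All as All using (All; []; _∷_)
open import Data.Rational using (ℚ; 0ℚ; 1ℚ; _⊔_; _⊓_)
  renaming (_≤_ to _≤ℚ_; _<_ to _<ℚ_; _+_ to _+ℚ_; -_ to -ℚ_)
open import Data.Rational.Properties
  using ( ≤-refl; ≤-trans; <⇒≤; ≤-<-trans; <-≤-trans; _≤?_; _<?_
        ; ≰⇒>; ≮⇒≥; <-irrefl; +-identityʳ; +-monoʳ-<; positive⁻¹; negative⁻¹
        ; ⊔-sel; ⊓-sel; ⊔-lub; p≤p⊔q; p≤q⊔p; p⊓q≤p; p⊓q≤q )
open import Relation.Binary.PropositionalEquality using (_≡_; refl; sym; trans; cong; subst)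
open import Relation.Nullary using (¬_; yes; no)
open import Relation.Nullary.Decidable using (map′; _×-dec_; decidable-stable)
open import Relation.Unary using (Decidable)
open import Relation.Unary.Properties using (∅?; _∪?_)

<⇒≱ : ∀ {p q} → p <ℚ q → ¬ q ≤ℚ p
<⇒≱ p<q q≤p = <-irrefl refl (<-≤-trans p<q q≤p)

q-1<q : ∀ q → q +ℚ -ℚ 1ℚ <ℚ q
q-1<q q = subst (q +ℚ -ℚ 1ℚ <ℚ_) (+-identityʳ q) (+-monoʳ-< q (negative⁻¹ (-ℚ 1ℚ)))

q<q+1 : ∀ q → q <ℚ q +ℚ 1ℚ
q<q+1 q = subst (_<ℚ q +ℚ 1ℚ) (+-identityʳ q) (+-monoʳ-< q (positive⁻¹ 1ℚ))

⊔-lub-< : ∀ {p q r} → p <ℚ r → q <ℚ r → p ⊔ q <ℚ r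
⊔-lub-< {p} {q} p<r q<r with ⊔-sel p q
... | inj₁ p⊔q≡p = subst (_<ℚ _) (sym p⊔q≡p) p<r
... | inj₂ p⊔q≡q = subst (_<ℚ _) (sym p⊔q≡q) q<r

⊓-glb-< : ∀ {p q r} → r <ℚ p → r <ℚ q → r <ℚ p ⊓ q
⊓-glb-< {p} {q} r<p r<q with ⊓-sel p q
... | inj₁ p⊓q≡p = subst (_ <ℚ_) (sym p⊓q≡p) r<p
... | inj₂ p⊓q≡q = subst (_ <ℚ_) (sym p⊓q≡q) r<q

Interval : ℚ → ℚ → Subset
Interval l r x = l ≤ℚ proj₁ x × proj₁ x <ℚ r

Disjoint : Subset → Subset → Set
Disjoint a b = ∀ x → a x → b x → ⊥

Avoids : Subset → ℚ → Set
Avoids b q = ∃₂ λ l r → l <ℚ q × q <ℚ r × Disjoint (Interval l r) b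

Covers : Subset → ℚ → ℚ → Set
Covers b l r = 0ℚ ≤ℚ l × r ≤ℚ 1ℚ × Interval l r ⊆ b

CoversLeftOf : Subset → ℚ → Set
CoversLeftOf b q = ∃₂ λ l r → l <ℚ q × q ≤ℚ r × Covers b l r

CoversRightOf : Subset → ℚ → Set
CoversRightOf b q = ∃₂ λ l r → l ≤ℚ q × q <ℚ r × Covers b l r

data Germ (b : Subset) (q : ℚ) : Set where
  avoids      : Avoids b q → Germ b q
  coversLeft  : CoversLeftOf b q → Germ b q
  coversRight : CoversRightOf b q → Germ b q

covered-point : ∀ {b l r m} → Covers b l r → l ≤ℚ m → m <ℚ r → X
covered-point {m = m} (0≤l , r≤1 , _) l≤m m<r = m , ≤-trans 0≤l l≤m , <-≤-trans m<r r≤1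

covered-point-∈ : ∀ {b l r m} (c : Covers b l r) (l≤m : l ≤ℚ m) (m<r : m <ℚ r) →
  b (covered-point c l≤m m<r)
covered-point-∈ (_ , _ , I⊆b) l≤m m<r = I⊆b _ (l≤m , m<r)

avoids-antitone : ∀ {a b q} → a ⊆ b → Avoids b q → Avoids a q
avoids-antitone a⊆b (l , r , l<q , q<r , I∩b=∅) =
  l , r , l<q , q<r , λ x x∈I x∈a → I∩b=∅ x x∈I (a⊆b x x∈a)

covers-monotone : ∀ {a b l r} → a ⊆ b → Covers a l r → Covers b l r
covers-monotone a⊆b (0≤l , r≤1 , I⊆a) = 0≤l , r≤1 , λ x x∈I → a⊆b x (I⊆a x x∈I)

germ-resp-≐ : ∀ {a b q} → a ≐ b → Germ a q → Germ b q
germ-resp-≐ (_ , b⊆a) (avoids av) = avoids (avoids-antitone b⊆a av)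
germ-resp-≐ (a⊆b , _) (coversLeft (l , r , l<q , q≤r , c)) =
  coversLeft (l , r , l<q , q≤r , covers-monotone a⊆b c)
germ-resp-≐ (a⊆b , _) (coversRight (l , r , l≤q , q<r , c)) =
  coversRight (l , r , l≤q , q<r , covers-monotone a⊆b c)

germ-∅ : ∀ q → Germ ∅ₛ q
germ-∅ q = avoids (q +ℚ -ℚ 1ℚ , q +ℚ 1ℚ , q-1<q q , q<q+1 q , λ _ _ ())

germ-∪ : ∀ {a b q} → Germ a q → Germ b q → Germ (a ∪ b) q
germ-∪ (coversLeft (l , r , l<q , q≤r , c)) _ =
  coversLeft (l , r , l<q , q≤r , covers-monotone (λ _ → inj₁) c)
germ-∪ (coversRight (l , r , l≤q , q<r , c)) _ =
  coversRight (l , r , l≤q , q<r , covers-monotone (λ _ → inj₁) c)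
germ-∪ (avoids _) (coversLeft (l , r , l<q , q≤r , c)) =
  coversLeft (l , r , l<q , q≤r , covers-monotone (λ _ → inj₂) c)
germ-∪ (avoids _) (coversRight (l , r , l≤q , q<r , c)) =
  coversRight (l , r , l≤q , q<r , covers-monotone (λ _ → inj₂) c)
germ-∪ (avoids (l , r , l<q , q<r , I∩a=∅)) (avoids (l′ , r′ , l′<q , q<r′ , I′∩b=∅)) =
  avoids (l ⊔ l′ , r ⊓ r′ , ⊔-lub-< l<q l′<q , ⊓-glb-< q<r q<r′ , I∩[a∪b]=∅)
  where
    I∩[a∪b]=∅ : Disjoint (Interval (l ⊔ l′) (r ⊓ r′)) (_ ∪ _)
    I∩[a∪b]=∅ x (m≤x , x<m′) (inj₁ x∈a) =
      I∩a=∅ x (≤-trans (p≤p⊔q l l′) m≤x , <-≤-trans x<m′ (p⊓q≤p r r′)) x∈a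
    I∩[a∪b]=∅ x (m≤x , x<m′) (inj₂ x∈b) =
      I′∩b=∅ x (≤-trans (p≤q⊔p l l′) m≤x , <-≤-trans x<m′ (p⊓q≤q r r′)) x∈b

Interval-empty : ∀ {l r} → r ≤ℚ l → ∀ x → ¬ Interval l r x
Interval-empty r≤l x (l≤x , x<r) = <⇒≱ x<r (≤-trans r≤l l≤x)

Interval-disjointˡ : ∀ {a b l r} → b ≤ℚ l → Disjoint (Interval a b) (Interval l r)
Interval-disjointˡ b≤l x (_ , x<b) (l≤x , _) = <⇒≱ x<b (≤-trans b≤l l≤x)

Interval-disjointʳ : ∀ {a b l r} → r ≤ℚ a → Disjoint (Interval a b) (Interval l r)
Interval-disjointʳ r≤a x (a≤x , _) (_ , x<r) = <⇒≱ x<r (≤-trans r≤a a≤x)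

germ-Interval : ∀ {l r} → 0ℚ ≤ℚ l → r ≤ℚ 1ℚ → ∀ q → Germ (Interval l r) q
germ-Interval {l} {r} 0≤l r≤1 q with q <? r
... | yes q<r with l ≤? q
...   | yes l≤q = coversRight (l , r , l≤q , q<r , 0≤l , r≤1 , λ _ x∈I → x∈I)
...   | no l≰q  = avoids (q +ℚ -ℚ 1ℚ , l , q-1<q q , ≰⇒> l≰q , Interval-disjointˡ ≤-refl)
germ-Interval {l} {r} 0≤l r≤1 q | no q≮r with r <? q
...   | yes r<q = avoids (r , q +ℚ 1ℚ , r<q , q<q+1 q , Interval-disjointʳ ≤-refl)
...   | no r≮q with l <? q
...     | yes l<q = coversLeft (l , r , l<q , ≮⇒≥ r≮q , 0≤l , r≤1 , λ _ x∈I → x∈I)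
...     | no l≮q  = avoids (q +ℚ -ℚ 1ℚ , q +ℚ 1ℚ , q-1<q q , q<q+1 q ,
                            λ x _ → Interval-empty (≤-trans (≮⇒≥ q≮r) (≮⇒≥ l≮q)) x)

coversLeftOf-disjoint : ∀ {a b q} → Disjoint a b → CoversLeftOf a q → CoversLeftOf b q → ⊥
coversLeftOf-disjoint {q = q} a∩b=∅ (l , r , l<q , q≤r , ca) (l′ , r′ , l′<q , q≤r′ , _ , _ , I′⊆b) =
  a∩b=∅ x (covered-point-∈ ca l≤m (<-≤-trans m<q q≤r))
          (I′⊆b x (p≤q⊔p l l′ , <-≤-trans m<q q≤r′))
  where
    m<q : l ⊔ l′ <ℚ q
    m<q = ⊔-lub-< l<q l′<q
    l≤m : l ≤ℚ l ⊔ l′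
    l≤m = p≤p⊔q l l′
    x : X
    x = covered-point ca l≤m (<-≤-trans m<q q≤r)

coversRightOf-disjoint : ∀ {a b q} → Disjoint a b → CoversRightOf a q → CoversRightOf b q → ⊥
coversRightOf-disjoint a∩b=∅ (l , r , l≤q , q<r , ca) (l′ , r′ , l′≤q , q<r′ , _ , _ , I′⊆b) =
  a∩b=∅ (covered-point ca l≤q q<r) (covered-point-∈ ca l≤q q<r) (I′⊆b _ (l′≤q , q<r′))

one-of-three-avoids : ∀ {a b c q} → Disjoint a b → Disjoint a c → Disjoint b c →
  Germ a q → Germ b q → Germ c q → Avoids a q ⊎ Avoids b q ⊎ Avoids c q
one-of-three-avoids _ _ _ (avoids av) _ _ = inj₁ av
one-of-three-avoids _ _ _ _ (avoids av) _ = inj₂ (inj₁ av)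
one-of-three-avoids _ _ _ _ _ (avoids av) = inj₂ (inj₂ av)
one-of-three-avoids ab _ _ (coversLeft ha) (coversLeft hb) _ = ⊥-elim (coversLeftOf-disjoint ab ha hb)
one-of-three-avoids ab _ _ (coversRight ha) (coversRight hb) _ = ⊥-elim (coversRightOf-disjoint ab ha hb)
one-of-three-avoids _ ac _ (coversLeft ha) (coversRight _) (coversLeft hc) = ⊥-elim (coversLeftOf-disjoint ac ha hc)
one-of-three-avoids _ _ bc (coversLeft _) (coversRight hb) (coversRight hc) = ⊥-elim (coversRightOf-disjoint bc hb hc)
one-of-three-avoids _ ac _ (coversRight ha) (coversLeft _) (coversRight hc) = ⊥-elim (coversRightOf-disjoint ac ha hc)
one-of-three-avoids _ _ bc (coversRight _) (coversLeft hb) (coversLeft hc) = ⊥-elim (coversLeftOf-disjoint bc hb hc)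

⋃< : ℕ → (ℕ → Subset) → Subset
⋃< n A x = ∃ λ i → i <ℕ n × A i x

∅≐⋃<0 : ∀ A → ∅ₛ ≐ ⋃< 0 A
∅≐⋃<0 A = (λ _ ()) , λ { _ (_ , () , _) }

⋃<-suc : ∀ A n → (⋃< n A ∪ A n) ≐ ⋃< (suc n) A
⋃<-suc A n = to , from
  where
    to : (⋃< n A ∪ A n) ⊆ ⋃< (suc n) A
    to x (inj₁ (i , i<n , x∈Ai)) = i , ℕ.m<n⇒m<1+n i<n , x∈Ai
    to x (inj₂ x∈An) = n , ℕ.n<1+n n , x∈An
    from : ⋃< (suc n) A ⊆ (⋃< n A ∪ A n)
    from x (i , i<1+n , x∈Ai) with ℕ.m<1+n⇒m<n∨m≡n i<1+n
    ... | inj₁ i<n = inj₁ (i , i<n , x∈Ai)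
    ... | inj₂ refl = inj₂ x∈Ai

⋃<-closed : (P : Subset → Set) → (∀ {a b} → a ≐ b → P a → P b) →
  P ∅ₛ → (∀ {a b} → P a → P b → P (a ∪ b)) →
  ∀ A → (∀ i → P (A i)) → ∀ n → P (⋃< n A)
⋃<-closed P resp P∅ P∪ A PA zero = resp (∅≐⋃<0 A) P∅
⋃<-closed P resp P∅ P∪ A PA (suc n) = resp (⋃<-suc A n) (P∪ (⋃<-closed P resp P∅ P∪ A PA n) (PA n))

decidable-resp-≐ : ∀ {a b} → a ≐ b → Decidable a → Decidable b
decidable-resp-≐ (a⊆b , b⊆a) a? x = map′ (a⊆b x) (b⊆a x) (a? x)

Interval? : ∀ l r → Decidable (Interval l r)
Interval? l r x = (l ≤? proj₁ x) ×-dec (proj₁ x <? r)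

lo hi : (ℕ → X1) → ℕ → ℚ
lo s i = proj₁ (s (2 * i))
hi s i = proj₁ (s (2 * i + 1))

0≤lo : ∀ s i → 0ℚ ≤ℚ lo s i
0≤lo s i = proj₁ (proj₂ (s (2 * i)))

hi≤1 : ∀ s i → hi s i ≤ℚ 1ℚ
hi≤1 s i = proj₂ (proj₂ (s (2 * i + 1)))

segment : (ℕ → X1) → ℕ → Subset
segment s i = Interval (lo s i) (hi s i)

⋃<segment≐ : ∀ {a} k s → IsSeq a k s → ⋃< k (segment s) ≐ a
⋃<segment≐ _ _ (_ , a⇔⋃) = (λ x → proj₂ (a⇔⋃ x)) , (λ x → proj₁ (a⇔⋃ x))

good⇒germ : ∀ {b} → Good b → ∀ q → Germ b q
good⇒germ (k , s , seq) q =
  germ-resp-≐ (⋃<segment≐ k s seq)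
    (⋃<-closed (λ b → Germ b q) germ-resp-≐ (germ-∅ q) germ-∪ (segment s)
      (λ i → germ-Interval (0≤lo s i) (hi≤1 s i) q) k)

good⇒decidable : ∀ {b} → Good b → Decidable b
good⇒decidable (k , s , seq) =
  decidable-resp-≐ (⋃<segment≐ k s seq)
    (⋃<-closed Decidable decidable-resp-≐ ∅? _∪?_ (segment s) (λ i → Interval? (lo s i) (hi s i)) k)

covers⇒¬avoids : ∀ {a l r q} → Covers a l r → l <ℚ r → l ≤ℚ q → q ≤ℚ r → ¬ Avoids a q
covers⇒¬avoids {l = l} {r} {q} ca l<r l≤q q≤r (l′ , r′ , l′<q , q<r′ , I′∩a=∅) =
  I′∩a=∅ x (p≤q⊔p l l′ , ≤-<-trans m≤q q<r′) (covered-point-∈ ca l≤m m<r)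
  where
    l≤m : l ≤ℚ l ⊔ l′
    l≤m = p≤p⊔q l l′
    m≤q : l ⊔ l′ ≤ℚ q
    m≤q = ⊔-lub l≤q (<⇒≤ l′<q)
    m<r : l ⊔ l′ <ℚ r
    m<r = ⊔-lub-< l<r (<-≤-trans l′<q q≤r)
    x : X
    x = covered-point ca l≤m m<r

suc[2n+1]≡2[1+n] : ∀ n → suc (2 * n + 1) ≡ 2 * suc n
suc[2n+1]≡2[1+n] n = trans (cong suc (ℕ.+-comm (2 * n) 1)) (sym (ℕ.*-suc 2 n))

even-or-odd : ∀ i → ∃ λ j → i ≡ 2 * j ⊎ i ≡ 2 * j + 1
even-or-odd zero = 0 , inj₁ refl
even-or-odd (suc i) with even-or-odd i
... | j , inj₁ refl = j , inj₂ (ℕ.+-comm 1 (2 * j))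
... | j , inj₂ refl = suc j , inj₁ (suc[2n+1]≡2[1+n] j)

2n<2n+1 : ∀ n → 2 * n <ℕ 2 * n + 1
2n<2n+1 n = ℕ.m<m+n (2 * n) (s≤s z≤n)

2n+1<2m : ∀ {n m} → n <ℕ m → 2 * n + 1 <ℕ 2 * m
2n+1<2m {n} {m} n<m = subst (_≤ℕ 2 * m) (sym (suc[2n+1]≡2[1+n] n)) (ℕ.*-monoʳ-≤ 2 n<m)

module _ {a : Subset} (k : ℕ) (s : ℕ → X1) (seq : IsSeq a k s) where

  lo<hi : ∀ {j} → j <ℕ k → lo s j <ℚ hi s j
  lo<hi {j} j<k = proj₁ seq _ _ (2n<2n+1 j) (2n+1<2m j<k)

  segment-covered : ∀ {j} → j <ℕ k → Covers a (lo s j) (hi s j)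
  segment-covered {j} j<k =
    0≤lo s j , hi≤1 s j , λ x x∈segment → proj₂ (proj₂ seq x) (j , j<k , x∈segment)

  endpoint-in-segment : ∀ {i} → i <ℕ 2 * k →
    ∃ λ j → j <ℕ k × lo s j ≤ℚ proj₁ (s i) × proj₁ (s i) ≤ℚ hi s j
  endpoint-in-segment {i} i<2k with even-or-odd i
  ... | j , inj₁ refl = j , j<k , ≤-refl , <⇒≤ (lo<hi j<k)
    where j<k = ℕ.*-cancelˡ-< 2 j k i<2k
  ... | j , inj₂ refl = j , j<k , <⇒≤ (lo<hi j<k) , ≤-refl
    where j<k = ℕ.*-cancelˡ-< 2 j k (ℕ.≤-<-trans (ℕ.m≤m+n (2 * j) 1) i<2k)

  endpoint-¬avoided : ∀ {i} → i <ℕ 2 * k → ¬ Avoids a (proj₁ (s i))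
  endpoint-¬avoided i<2k with endpoint-in-segment i<2k
  ... | j , j<k , lo≤sᵢ , sᵢ≤hi = covers⇒¬avoids (segment-covered j<k) (lo<hi j<k) lo≤sᵢ sᵢ≤hi

good⇒empty⊎nonempty : ∀ {b} → Good b → (∀ x → ¬ b x) ⊎ Nonempty b
good⇒empty⊎nonempty (zero , s , seq) =
  inj₁ λ x x∈b → proj₂ (∅≐⋃<0 (segment s)) x (proj₂ (⋃<segment≐ zero s seq) x x∈b)
good⇒empty⊎nonempty (suc k , s , seq) =
  inj₂ (covered-point cov ≤-refl lo<hi₀ , covered-point-∈ cov ≤-refl lo<hi₀)
  where
    cov = segment-covered (suc k) s seq (s≤s z≤n)
    lo<hi₀ = lo<hi (suc k) s seq (s≤s z≤n)

module _ {C : Subset → Set} (C-subalgebra : BooleanSubalgebraOfB C) (C-atomless : Atomless C) where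
  open BooleanSubalgebraOfB C-subalgebra

  difference-closed : ∀ {a b} → C a → C b → C (a ∩ ∁ b)
  difference-closed {a} {b} Ca Cb = ∩-closed a (∁ b) Ca (∁-closed b Cb)

  difference-nonempty : ∀ {a b} → C a → C b → ¬ (a ⊆ b) → Nonempty (a ∩ ∁ b)
  difference-nonempty {a} {b} Ca Cb a⊈b with good⇒empty⊎nonempty (good _ (difference-closed Ca Cb))
  ... | inj₂ a∖b≠∅ = a∖b≠∅
  ... | inj₁ a∖b=∅ = ⊥-elim (a⊈b λ x x∈a →
          decidable-stable (good⇒decidable (good b Cb) x) (λ x∉b → a∖b=∅ x (x∈a , x∉b)))

  avoiding-subset : ∀ {a} → C a → Nonempty a → ∀ q → ∃ λ b → C b × b ⊆ a × Nonempty b × Avoids b q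
  avoiding-subset {a} Ca a≠∅ q with C-atomless a Ca a≠∅
  ... | b , Cb , b⊆a , b≠∅ , a⊈b with C-atomless b Cb b≠∅
  ... | c , Cc , c⊆b , c≠∅ , b⊈c =
    choose (one-of-three-avoids c∩[b∖c]=∅ c∩[a∖b]=∅ [b∖c]∩[a∖b]=∅
             (germ Cc) (germ (difference-closed Cb Cc)) (germ (difference-closed Ca Cb)))
    where
      germ : ∀ {d} → C d → Germ d q
      germ Cd = good⇒germ (good _ Cd) q
      c∩[b∖c]=∅ : Disjoint c (b ∩ ∁ c)
      c∩[b∖c]=∅ x x∈c (_ , x∉c) = x∉c x∈c
      c∩[a∖b]=∅ : Disjoint c (a ∩ ∁ b)
      c∩[a∖b]=∅ x x∈c (_ , x∉b) = x∉b (c⊆b x x∈c)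
      [b∖c]∩[a∖b]=∅ : Disjoint (b ∩ ∁ c) (a ∩ ∁ b)
      [b∖c]∩[a∖b]=∅ x (x∈b , _) (_ , x∉b) = x∉b x∈b
      choose : Avoids c q ⊎ Avoids (b ∩ ∁ c) q ⊎ Avoids (a ∩ ∁ b) q →
        ∃ λ d → C d × d ⊆ a × Nonempty d × Avoids d q
      choose (inj₁ av) = c , Cc , (λ x x∈c → b⊆a x (c⊆b x x∈c)) , c≠∅ , av
      choose (inj₂ (inj₁ av)) =
        b ∩ ∁ c , difference-closed Cb Cc , (λ x x∈b∖c → b⊆a x (proj₁ x∈b∖c)) ,
        difference-nonempty Cb Cc b⊈c , av
      choose (inj₂ (inj₂ av)) =
        a ∩ ∁ b , difference-closed Ca Cb , (λ x → proj₁) , difference-nonempty Ca Cb a⊈b , av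

  avoiding-all-subset : ∀ (F : List ℚ) {a} → C a → Nonempty a →
    ∃ λ b → C b × b ⊆ a × Nonempty b × All (Avoids b) F
  avoiding-all-subset [] {a} Ca a≠∅ = a , Ca , (λ _ x∈a → x∈a) , a≠∅ , []
  avoiding-all-subset (q ∷ F) Ca a≠∅ with avoiding-all-subset F Ca a≠∅
  ... | b , Cb , b⊆a , b≠∅ , b-avoids-F with avoiding-subset Cb b≠∅ q
  ... | c , Cc , c⊆b , c≠∅ , c-avoids-q =
    c , Cc , (λ x x∈c → b⊆a x (c⊆b x x∈c)) , c≠∅ ,
    c-avoids-q ∷ All.map (avoids-antitone c⊆b) b-avoids-F

finite-to-one⇒finite-≤-preimage : ∀ {e : X1 → ℕ} → FiniteToOne e → ∀ n →
  ∃ λ (L : List ℚ) → ∀ u → e u ≤ℕ n → proj₁ u ∈ L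
finite-to-one⇒finite-≤-preimage fe zero with fe zero
... | L , fibre⊆L = L , λ u eu≤0 → fibre⊆L u (ℕ.n≤0⇒n≡0 eu≤0)
finite-to-one⇒finite-≤-preimage {e} fe (suc n) with fe (suc n) | finite-to-one⇒finite-≤-preimage fe n
... | L , fibre⊆L | L′ , preimage⊆L′ = L ++ L′ , λ u eu≤1+n → split u (ℕ.m≤n⇒m<n∨m≡n eu≤1+n)
  where
    split : ∀ u → e u <ℕ suc n ⊎ e u ≡ suc n → proj₁ u ∈ L ++ L′
    split u (inj₁ (s≤s eu≤n)) = ∈-++⁺ʳ L (preimage⊆L′ u eu≤n)
    split u (inj₂ eu≡1+n) = ∈-++⁺ˡ (fibre⊆L u eu≡1+n)

lemma3p3 : (e : X1 → ℕ) → FiniteToOne e →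
    (C : Subset → Set) → BooleanSubalgebraOfB C → Countable C → Atomless C →
    ∀ a → C a → Nonempty a → (n : ℕ) →
    ∃ λ b → C b × (b ⊆ a) × Nonempty b × MinIntAbove e b n
lemma3p3 e fe C C-subalgebra _ C-atomless a Ca a≠∅ n
  with finite-to-one⇒finite-≤-preimage fe n
... | F , preimage⊆F with avoiding-all-subset C-subalgebra C-atomless F Ca a≠∅
... | b , Cb , b⊆a , b≠∅ , b-avoids-F with BooleanSubalgebraOfB.good C-subalgebra b Cb
... | k , s , seq = b , Cb , b⊆a , b≠∅ , k , s , seq , endpoint-above
  where
    endpoint-above : ∀ i → i <ℕ 2 * k → n <ℕ e (s i)
    endpoint-above i i<2k with e (s i) ℕ.≤? n
    ... | yes e≤n = ⊥-elim (endpoint-¬avoided k s seq i<2k (All.lookup b-avoids-F (preimage⊆F (s i) e≤n)))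
    ... | no e≰n = ℕ.≰⇒> e≰n
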